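{- Let $k>1$ be an integer and let $S(k,m)=\sum_{i=1}^m i^k$ for positive integers $m$. For a positive integer $n$ put $s=\left\lfloor\sqrt[k+1]{(k+1)n}\right\rfloor$. Then the $n$-th smallest positive integer not of the form $S(k,m)$ ($m\ge1$) equals $$a(n)=\begin{cases} n+s & \text{if } (k+1)(n+s)>\sum_{j=0}^{k}\binom{k+1}{j}B^+_j\, s^{k+1-j},\\ n+s-1 & \text{otherwise.}\end{cases}$$
   Context: $B^+_j$ denote the Bernoulli numbers with the convention $B^+_1=\frac12$, i.e. defined by $\frac{t}{1-e^{ -t}}=\sum_{j\ge0}B^+_j\frac{t^j}{j!}$ (so $B^+_0=1$, $B^+_1=\frac12$, $B^+_2=\frac16$, ...). With this convention $\sum_{i=1}^m i^k=\frac{1}{k+1}\sum_{j=0}^k\binom{k+1}{j}B^+_j m^{k+1-j}$. -}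

module Defs where

open import Data.Nat as ℕ using (ℕ; zero; suc; _^_; _≤_; _<_)
open import Data.Nat.Combinatorics using (_C_)
open import Data.Integer using (+_)
open import Data.Rational as ℚ using (ℚ; _/_; 0ℚ; 1ℚ)
open import Data.Fin as Fin using (Fin; toℕ)
open import Data.Vec as Vec using (Vec; []; _∷_; _∷ʳ_)
open import Data.List as List using (List; upTo)
open import Data.Product using (Σ; ∃; _×_)
open import Relation.Binary.PropositionalEquality using (_≡_; _≢_)

ℕ→ℚ : ℕ → ℚ
ℕ→ℚ n = (+ n) / 1

sumℚ : List ℚ → ℚ
sumℚ = List.foldr ℚ._+_ 0ℚ

-- Bernoulli numbers B⁺_j (convention B⁺_1 = 1/2), i.e. t/(1-e^{-t}) = Σ B⁺_j t^j/j!.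
-- Equivalently (coefficient comparison) they are determined by B⁺_0 = 1 and
--   Σ_{j=0}^{n} C(n+1,j) B⁺_j = n+1   for all n,
-- which is the recursion used here.
-- bernoulliVec n = [B⁺_0, …, B⁺_n]
bernoulliVec : (n : ℕ) → Vec ℚ (suc n)
bernoulliVec zero = 1ℚ ∷ []
bernoulliVec (suc n) = bs ∷ʳ next
  where
  bs : Vec ℚ (suc n)
  bs = bernoulliVec n
  partial : ℚ
  partial = Vec.foldr _ ℚ._+_ 0ℚ
              (Vec.tabulate (λ (i : Fin (suc n)) → ℕ→ℚ (suc (suc n) C toℕ i) ℚ.* Vec.lookup bs i))
  next : ℚ
  next = (ℕ→ℚ (suc (suc n)) ℚ.- partial) ℚ.* ((+ 1) / suc (suc n))

B⁺ : ℕ → ℚ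
B⁺ n = Vec.last (bernoulliVec n)

S : ℕ → ℕ → ℕ
S k zero = 0
S k (suc m) = S k m ℕ.+ suc m ^ k

bernoulliSum : ℕ → ℕ → ℚ
bernoulliSum k s =
  sumℚ (List.map (λ j → ℕ→ℚ ((suc k C j) ℕ.* s ^ (suc k ℕ.∸ j)) ℚ.* B⁺ j) (upTo (suc k)))

NotPowerSum : ℕ → ℕ → Set
NotPowerSum k x = 1 ≤ x × (∀ m → 1 ≤ m → S k m ≢ x)

NthSmallest : (ℕ → Set) → ℕ → ℕ → Set
NthSmallest P n a =
  Σ (Fin n → ℕ) λ f →
    (∀ i j → i Fin.< j → f i < f j) ×
    (∀ i → P (f i)) ×
    (∀ i → f i ≤ a) ×
    (∀ x → P x → x ≤ a → ∃ λ i → f i ≡ x) ×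
    P a

-- Faulhaber's formula turns bernoulliSum k s into (k+1) S(k,s), so the case distinction asks
-- whether S(k,s) < n + s. A number x with S(k,t) < x < S(k,t+1) is the (x - t)-th number that
-- is not a power sum, because exactly the t power sums S(k,1), ..., S(k,t) lie below it. The
-- hypothesis s^(k+1) ≤ (k+1) n < (s+1)^(k+1) together with the bounds
--   (k+1) S(k,t) < (t+1)^(k+1)   and   (s+1)^(k+1) + (k+1) s ≤ (k+1) S(k,s+1)   (for k ≥ 2)
-- places n + s in the gap after S(k,s) in the first case, and n + s - 1 in the gap after
-- S(k,s-1) in the second. Faulhaber's formula follows from B_m(x+2) - B_m(x+1) = m (x+1)^(m-1),
-- which is binomial expansion of (x+1)^(m-j) combined with Σ_{j<m} C(m,j) B⁺_j = m.

module Submission where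

open import Defs
open import Data.Nat
  using ( ℕ; zero; suc; _+_; _*_; _∸_; _^_; _!; _≤_; _<_; _≤′_; ≤′-refl; ≤′-step
        ; z≤n; s≤s; s≤s⁻¹; z<s)
open import Data.Nat.Properties
open import Data.Nat.Combinatorics
  using ( _C_; nCk≡n!/k![n-k]!; k![n∸k]!∣n!; k>n⇒nCk≡0; nCk≡nC[n∸k]; nCn≡1; nC1≡n
        ; nCk+nC[k+1]≡[n+1]C[k+1])
open import Data.Nat.DivMod using (m/n*n≡m)
open import Data.Nat.Coprimality using (1-coprimeTo) renaming (sym to coprime-sym)
open import Data.Nat.Tactic.RingSolver using (solve-∀)
import Data.Integer as ℤ
import Data.Integer.Properties as ℤₚ
open import Data.Rational as ℚ using (ℚ; mkℚ; 0ℚ; 1ℚ; _>_)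
import Data.Rational.Properties as ℚₚ
open import Data.Rational.Solver using (module +-*-Solver)
open import Algebra.Bundles using (CommutativeMonoid)
import Algebra.Properties.CommutativeSemigroup as CommutativeSemigroupProperties
import Algebra.Properties.Group as GroupProperties
open import Data.Fin as Fin using (Fin; toℕ; fromℕ; inject₁)
open import Data.Fin.Properties using (toℕ-fromℕ; toℕ-inject₁)
open import Data.Fin.Relation.Unary.Top using (view; ‵fromℕ; ‵inject₁)
import Data.Vec as Vec
open import Data.Vec.Properties using (last-∷ʳ)
open import Data.List as List using (List; []; _∷_; _∷ʳ_; length; applyUpTo)
open import Data.List.Properties using (length-++)
open import Data.List.Relation.Unary.All as All using (All; []; _∷_)
import Data.List.Relation.Unary.All.Properties as Allₚ
open import Data.List.Relation.Unary.AllPairs using (AllPairs; []; _∷_)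
import Data.List.Relation.Unary.AllPairs.Properties as AllPairsₚ
open import Data.List.Relation.Unary.Any as Any using (here)
open import Data.List.Relation.Unary.Any.Properties using (lookup-index)
open import Data.List.Membership.Propositional using (_∈_)
open import Data.List.Membership.Propositional.Properties using (∈-lookup; ∈-++⁺ˡ; ∈-++⁺ʳ)
open import Data.Product as Product using (∃; _×_; _,_; proj₁; proj₂)
open import Data.Sum using (inj₁; inj₂)
open import Function using (_∘_; _⇔_; mk⇔; Equivalence)
open import Relation.Nullary using (¬_; yes; no; contradiction)
open import Relation.Binary.PropositionalEquality

private
  open CommutativeMonoid using (commutativeSemigroup)
  module ℚ+ = CommutativeSemigroupProperties (commutativeSemigroup ℚₚ.+-0-commutativeMonoid)
  module ℚ* = CommutativeSemigroupProperties (commutativeSemigroup ℚₚ.*-1-commutativeMonoid)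
  module ℕ* = CommutativeSemigroupProperties *-commutativeSemigroup
  module ℚ+-group = GroupProperties ℚₚ.+-0-group

ℕ→ℚ≡mkℚ : ∀ n → ℕ→ℚ n ≡ mkℚ (ℤ.+ n) 0 (coprime-sym (1-coprimeTo n))
ℕ→ℚ≡mkℚ n = ℚₚ.normalize-coprime _

-- ℚ's _+_ and _*_ are computed by _/_ from numerators and denominators, so once the arguments are
-- rewritten to normal form both sides are quotients with denominator 1.
ℕ→ℚ-homo-+ : ∀ m n → ℕ→ℚ (m + n) ≡ ℕ→ℚ m ℚ.+ ℕ→ℚ n
ℕ→ℚ-homo-+ m n rewrite ℕ→ℚ≡mkℚ m | ℕ→ℚ≡mkℚ n =
  ℚₚ./-cong (sym (cong₂ ℤ._+_ (ℤₚ.*-identityʳ (ℤ.+ m)) (ℤₚ.*-identityʳ (ℤ.+ n)))) refl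

ℕ→ℚ-homo-* : ∀ m n → ℕ→ℚ (m * n) ≡ ℕ→ℚ m ℚ.* ℕ→ℚ n
ℕ→ℚ-homo-* m n rewrite ℕ→ℚ≡mkℚ m | ℕ→ℚ≡mkℚ n = ℚₚ./-cong (ℤₚ.pos-* m n) refl

ℕ→ℚ-*-inverseʳ : ∀ n → ℕ→ℚ (suc n) ℚ.* (ℤ.+ 1 ℚ./ suc n) ≡ 1ℚ
ℕ→ℚ-*-inverseʳ n
  rewrite ℕ→ℚ≡mkℚ (suc n) | ℚₚ.normalize-coprime {1} {n} (1-coprimeTo (suc n)) =
  ℚₚ.*-inverseʳ (mkℚ (ℤ.+ suc n) 0 (coprime-sym (1-coprimeTo (suc n))))

ℕ→ℚ-mono-< : ∀ {m n} → m < n → ℕ→ℚ m ℚ.< ℕ→ℚ n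
ℕ→ℚ-mono-< {m} {n} m<n rewrite ℕ→ℚ≡mkℚ m | ℕ→ℚ≡mkℚ n =
  ℚ.*<* (subst₂ ℤ._<_ (sym (ℤₚ.*-identityʳ (ℤ.+ m))) (sym (ℤₚ.*-identityʳ (ℤ.+ n))) (ℤ.+<+ m<n))

ℕ→ℚ-cancel-< : ∀ {m n} → ℕ→ℚ m ℚ.< ℕ→ℚ n → m < n
ℕ→ℚ-cancel-< {m} {n} lt rewrite ℕ→ℚ≡mkℚ m | ℕ→ℚ≡mkℚ n =
  ℤₚ.drop‿+<+ (subst₂ ℤ._<_ (ℤₚ.*-identityʳ (ℤ.+ m)) (ℤₚ.*-identityʳ (ℤ.+ n)) (ℚₚ.drop-*<* lt))

∑ : ℕ → (ℕ → ℚ) → ℚ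
∑ zero    f = 0ℚ
∑ (suc n) f = f 0 ℚ.+ ∑ n (f ∘ suc)

infix 5 ∑
syntax ∑ n (λ i → e) = ∑[ i < n ] e

∑-cong : ∀ n {f g : ℕ → ℚ} → (∀ {i} → i < n → f i ≡ g i) → ∑ n f ≡ ∑ n g
∑-cong zero    f≡g = refl
∑-cong (suc n) f≡g = cong₂ ℚ._+_ (f≡g z<s) (∑-cong n (λ i<n → f≡g (s≤s i<n)))

∑-zero : ∀ n {f : ℕ → ℚ} → (∀ {i} → i < n → f i ≡ 0ℚ) → ∑ n f ≡ 0ℚ
∑-zero zero    f≡0 = refl
∑-zero (suc n) f≡0 =
  trans (cong₂ ℚ._+_ (f≡0 z<s) (∑-zero n (λ i<n → f≡0 (s≤s i<n)))) (ℚₚ.+-identityˡ 0ℚ)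

∑-distrib-+ : ∀ n (f g : ℕ → ℚ) → ∑[ i < n ] (f i ℚ.+ g i) ≡ ∑ n f ℚ.+ ∑ n g
∑-distrib-+ zero    f g = sym (ℚₚ.+-identityˡ 0ℚ)
∑-distrib-+ (suc n) f g = trans (cong (f 0 ℚ.+ g 0 ℚ.+_) (∑-distrib-+ n (f ∘ suc) (g ∘ suc)))
                                (ℚ+.interchange (f 0) (g 0) _ _)

*-distribˡ-∑ : ∀ n c (f : ℕ → ℚ) → c ℚ.* ∑ n f ≡ ∑[ i < n ] c ℚ.* f i
*-distribˡ-∑ zero    c f = ℚₚ.*-zeroʳ c
*-distribˡ-∑ (suc n) c f =
  trans (ℚₚ.*-distribˡ-+ c (f 0) _) (cong (c ℚ.* f 0 ℚ.+_) (*-distribˡ-∑ n c (f ∘ suc)))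

*-distribʳ-∑ : ∀ n c (f : ℕ → ℚ) → ∑ n f ℚ.* c ≡ ∑[ i < n ] f i ℚ.* c
*-distribʳ-∑ zero    c f = ℚₚ.*-zeroˡ c
*-distribʳ-∑ (suc n) c f =
  trans (ℚₚ.*-distribʳ-+ c (f 0) _) (cong (f 0 ℚ.* c ℚ.+_) (*-distribʳ-∑ n c (f ∘ suc)))

∑-init-last : ∀ n (f : ℕ → ℚ) → ∑ (suc n) f ≡ ∑ n f ℚ.+ f n
∑-init-last zero    f = trans (ℚₚ.+-identityʳ (f 0)) (sym (ℚₚ.+-identityˡ (f 0)))
∑-init-last (suc n) f =
  trans (cong (f 0 ℚ.+_) (∑-init-last n (f ∘ suc))) (sym (ℚₚ.+-assoc (f 0) _ _))

∑-comm : ∀ m n (f : ℕ → ℕ → ℚ) → ∑[ i < m ] ∑[ j < n ] f i j ≡ ∑[ j < n ] ∑[ i < m ] f i j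
∑-comm zero    n f = sym (∑-zero n (λ _ → refl))
∑-comm (suc m) n f =
  trans (cong (∑ n (f 0) ℚ.+_) (∑-comm m n (f ∘ suc))) (sym (∑-distrib-+ n (f 0) _))

∑-extend : ∀ {m n} (f : ℕ → ℚ) → m ≤ n → (∀ {i} → m ≤ i → i < n → f i ≡ 0ℚ) →
           ∑ n f ≡ ∑ m f
∑-extend {zero}  {n}     f _         f≡0 = ∑-zero n (f≡0 z≤n)
∑-extend {suc m} {suc n} f (s≤s m≤n) f≡0 =
  cong (f 0 ℚ.+_) (∑-extend (f ∘ suc) m≤n (λ m≤i i<n → f≡0 (s≤s m≤i) (s≤s i<n)))

∑-reverse : ∀ n (f : ℕ → ℚ) → ∑ n f ≡ ∑[ i < n ] f (n ∸ suc i)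
∑-reverse zero    f = refl
∑-reverse (suc n) f = begin
  ∑ (suc n) f                         ≡⟨ ∑-init-last n f ⟩
  ∑ n f ℚ.+ f n                       ≡⟨ cong (ℚ._+ f n) (∑-reverse n f) ⟩
  (∑[ i < n ] f (n ∸ suc i)) ℚ.+ f n  ≡⟨ ℚₚ.+-comm _ (f n) ⟩
  f n ℚ.+ (∑[ i < n ] f (n ∸ suc i))  ∎
  where open ≡-Reasoning

sumℚ-map-applyUpTo : ∀ n (f : ℕ → ℚ) g →
                     sumℚ (List.map f (applyUpTo g n)) ≡ ∑[ i < n ] f (g i)
sumℚ-map-applyUpTo zero    f g = refl
sumℚ-map-applyUpTo (suc n) f g = cong (f (g 0) ℚ.+_) (sumℚ-map-applyUpTo n f (g ∘ suc))

foldr-+-tabulate : ∀ n (g : Fin n → ℚ) (f : ℕ → ℚ) → (∀ i → g i ≡ f (toℕ i)) →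
                   Vec.foldr _ ℚ._+_ 0ℚ (Vec.tabulate g) ≡ ∑ n f
foldr-+-tabulate zero    g f g≡f = refl
foldr-+-tabulate (suc n) g f g≡f =
  cong₂ ℚ._+_ (g≡f Fin.zero) (foldr-+-tabulate n (g ∘ Fin.suc) (f ∘ suc) (g≡f ∘ Fin.suc))

nCk*k![n∸k]!≡n! : ∀ {n k} → k ≤ n → (n C k) * (k ! * (n ∸ k) !) ≡ n !
nCk*k![n∸k]!≡n! {n} {k} k≤n =
  trans (cong (_* (k ! * (n ∸ k) !)) (nCk≡n!/k![n-k]! k≤n)) (m/n*n≡m (k![n∸k]!∣n! k≤n))
  where instance _ = k !* (n ∸ k) !≢0

private
  nCj*[n∸j]Ci*i!j![n∸[i+j]]!≡n! : ∀ {n} i j → i + j ≤ n →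
    (n C j) * ((n ∸ j) C i) * (i ! * j ! * (n ∸ (i + j)) !) ≡ n !
  nCj*[n∸j]Ci*i!j![n∸[i+j]]!≡n! {n} i j i+j≤n = begin
    (n C j) * ((n ∸ j) C i) * (i ! * j ! * (n ∸ (i + j)) !)
      ≡⟨ cong (λ r → (n C j) * ((n ∸ j) C i) * (i ! * j ! * r !)) n∸[i+j]≡n∸j∸i ⟩
    (n C j) * ((n ∸ j) C i) * (i ! * j ! * (n ∸ j ∸ i) !)
      ≡⟨ rearrange (n C j) ((n ∸ j) C i) (i !) (j !) ((n ∸ j ∸ i) !) ⟩
    (n C j) * (j ! * (((n ∸ j) C i) * (i ! * (n ∸ j ∸ i) !)))
      ≡⟨ cong (λ r → (n C j) * (j ! * r)) (nCk*k![n∸k]!≡n! (m+n≤o⇒m≤o∸n i i+j≤n)) ⟩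
    (n C j) * (j ! * (n ∸ j) !)
      ≡⟨ nCk*k![n∸k]!≡n! (m+n≤o⇒n≤o i i+j≤n) ⟩
    n ! ∎
    where
    open ≡-Reasoning
    n∸[i+j]≡n∸j∸i : n ∸ (i + j) ≡ n ∸ j ∸ i
    n∸[i+j]≡n∸j∸i = trans (cong (n ∸_) (+-comm i j)) (sym (∸-+-assoc n j i))
    rearrange : ∀ a b c d e → a * b * (c * d * e) ≡ a * (d * (b * (c * e)))
    rearrange = solve-∀

  nCj*[n∸j]Ci≡0 : ∀ {n} i j → n < i + j → (n C j) * ((n ∸ j) C i) ≡ 0
  nCj*[n∸j]Ci≡0 {n} i j n<i+j with j ≤? n
  ... | no  j≰n = cong (_* ((n ∸ j) C i)) (k>n⇒nCk≡0 (≰⇒> j≰n))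
  ... | yes j≤n = trans (cong ((n C j) *_) (k>n⇒nCk≡0 n∸j<i)) (*-zeroʳ (n C j))
    where
    n∸j<i : n ∸ j < i
    n∸j<i = subst (n ∸ j <_) (m+n∸n≡m i j) (∸-monoˡ-< n<i+j j≤n)

-- Multiplied by i! j! (n ∸ (i + j))!, both sides become n! when i + j ≤ n; otherwise both vanish.
nCj*[n∸j]Ci≡nCi*[n∸i]Cj : ∀ n i j → (n C j) * ((n ∸ j) C i) ≡ (n C i) * ((n ∸ i) C j)
nCj*[n∸j]Ci≡nCi*[n∸i]Cj n i j with i + j ≤? n
... | yes i+j≤n = *-cancelʳ-≡ _ _ (i ! * j ! * (n ∸ (i + j)) !) (trans
      (nCj*[n∸j]Ci*i!j![n∸[i+j]]!≡n! i j i+j≤n)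
      (sym (trans (cong ((n C i) * ((n ∸ i) C j) *_) factorials-comm)
                  (nCj*[n∸j]Ci*i!j![n∸[i+j]]!≡n! j i (subst (_≤ n) (+-comm i j) i+j≤n)))))
  where
  instance _ = m*n≢0 (i ! * j !) ((n ∸ (i + j)) !) {{i !* j !≢0}} {{(n ∸ (i + j)) !≢0}}
  factorials-comm : i ! * j ! * (n ∸ (i + j)) ! ≡ j ! * i ! * (n ∸ (j + i)) !
  factorials-comm = cong₂ (λ a b → a * (n ∸ b) !) (*-comm (i !) (j !)) (+-comm i j)
... | no i+j≰n = trans (nCj*[n∸j]Ci≡0 i j n<i+j)
                       (sym (nCj*[n∸j]Ci≡0 j i (subst (n <_) (+-comm i j) n<i+j)))
  where n<i+j = ≰⇒> i+j≰n

nCk*[n∸k]≡n*[n∸1]Ck : ∀ n k → (n C k) * (n ∸ k) ≡ n * ((n ∸ 1) C k)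
nCk*[n∸k]≡n*[n∸1]Ck n k = begin
  (n C k) * (n ∸ k)             ≡⟨ cong ((n C k) *_) (nC1≡n (n ∸ k)) ⟨
  (n C k) * ((n ∸ k) C 1)       ≡⟨ nCj*[n∸j]Ci≡nCi*[n∸i]Cj n k 1 ⟨
  (n C 1) * ((n ∸ 1) C k)       ≡⟨ cong (_* ((n ∸ 1) C k)) (nC1≡n n) ⟩
  n * ((n ∸ 1) C k)             ∎
  where open ≡-Reasoning

[1+n]Cn≡1+n : ∀ n → suc n C n ≡ suc n
[1+n]Cn≡1+n n = begin
  suc n C n              ≡⟨ nCk≡nC[n∸k] (n≤1+n n) ⟩
  suc n C (suc n ∸ n)    ≡⟨ cong (suc n C_) (m+n∸n≡m 1 n) ⟩
  suc n C 1              ≡⟨ nC1≡n (suc n) ⟩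
  suc n                  ∎
  where open ≡-Reasoning

binomial-expansion : ∀ x m {N} → m < N → ∑[ i < N ] ℕ→ℚ ((m C i) * x ^ i) ≡ ℕ→ℚ (suc x ^ m)
binomial-expansion x zero    {suc N} _ =
  trans (cong (ℕ→ℚ 1 ℚ.+_) (∑-zero N (λ _ → refl))) (ℚₚ.+-identityʳ (ℕ→ℚ 1))
binomial-expansion x (suc m) {suc N} (s≤s m<N) = begin
  T m 0 ℚ.+ (∑[ i < N ] T (suc m) (suc i))
    ≡⟨ cong (T m 0 ℚ.+_) (∑-cong N (λ {i} _ → pascal i)) ⟩
  T m 0 ℚ.+ (∑[ i < N ] (ℕ→ℚ x ℚ.* T m i ℚ.+ T m (suc i)))
    ≡⟨ cong (T m 0 ℚ.+_) (∑-distrib-+ N (λ i → ℕ→ℚ x ℚ.* T m i) (T m ∘ suc)) ⟩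
  T m 0 ℚ.+ ((∑[ i < N ] ℕ→ℚ x ℚ.* T m i) ℚ.+ (∑[ i < N ] T m (suc i)))
    ≡⟨ ℚ+.x∙yz≈y∙xz (T m 0) (∑[ i < N ] ℕ→ℚ x ℚ.* T m i) (∑[ i < N ] T m (suc i)) ⟩
  (∑[ i < N ] ℕ→ℚ x ℚ.* T m i) ℚ.+ (∑[ i < suc N ] T m i)
    ≡⟨ cong (ℚ._+ (∑[ i < suc N ] T m i)) (*-distribˡ-∑ N (ℕ→ℚ x) (T m)) ⟨
  ℕ→ℚ x ℚ.* (∑[ i < N ] T m i) ℚ.+ (∑[ i < suc N ] T m i)
    ≡⟨ cong₂ (λ p q → ℕ→ℚ x ℚ.* p ℚ.+ q) (binomial-expansion x m m<N)
                                        (binomial-expansion x m (m<n⇒m<1+n m<N)) ⟩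
  ℕ→ℚ x ℚ.* ℕ→ℚ (suc x ^ m) ℚ.+ ℕ→ℚ (suc x ^ m)
    ≡⟨ ℚₚ.+-comm (ℕ→ℚ x ℚ.* ℕ→ℚ (suc x ^ m)) (ℕ→ℚ (suc x ^ m)) ⟩
  ℕ→ℚ (suc x ^ m) ℚ.+ ℕ→ℚ x ℚ.* ℕ→ℚ (suc x ^ m)
    ≡⟨ cong (ℕ→ℚ (suc x ^ m) ℚ.+_) (ℕ→ℚ-homo-* x (suc x ^ m)) ⟨
  ℕ→ℚ (suc x ^ m) ℚ.+ ℕ→ℚ (x * suc x ^ m)
    ≡⟨ ℕ→ℚ-homo-+ (suc x ^ m) (x * suc x ^ m) ⟨
  ℕ→ℚ (suc x ^ suc m) ∎
  where
  open ≡-Reasoning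
  T : ℕ → ℕ → ℚ
  T m i = ℕ→ℚ ((m C i) * x ^ i)
  pascal : ∀ i → T (suc m) (suc i) ≡ ℕ→ℚ x ℚ.* T m i ℚ.+ T m (suc i)
  pascal i = begin
    ℕ→ℚ ((suc m C suc i) * x ^ suc i)
      ≡⟨ cong (λ c → ℕ→ℚ (c * x ^ suc i)) (nCk+nC[k+1]≡[n+1]C[k+1] m i) ⟨
    ℕ→ℚ ((m C i + m C suc i) * x ^ suc i)
      ≡⟨ cong ℕ→ℚ (distribute (m C i) (m C suc i) x (x ^ i)) ⟩
    ℕ→ℚ (x * ((m C i) * x ^ i) + (m C suc i) * x ^ suc i)
      ≡⟨ ℕ→ℚ-homo-+ (x * ((m C i) * x ^ i)) ((m C suc i) * x ^ suc i) ⟩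
    ℕ→ℚ (x * ((m C i) * x ^ i)) ℚ.+ T m (suc i)
      ≡⟨ cong (ℚ._+ T m (suc i)) (ℕ→ℚ-homo-* x ((m C i) * x ^ i)) ⟩
    ℕ→ℚ x ℚ.* T m i ℚ.+ T m (suc i) ∎
    where
    distribute : ∀ a b x p → (a + b) * (x * p) ≡ x * (a * p) + b * (x * p)
    distribute = solve-∀

-- Bernoulli numbers

lookup-∷ʳ-inject₁ : ∀ {A : Set} {n} (xs : Vec.Vec A n) x i →
                    Vec.lookup (xs Vec.∷ʳ x) (inject₁ i) ≡ Vec.lookup xs i
lookup-∷ʳ-inject₁ (y Vec.∷ xs) x Fin.zero    = refl
lookup-∷ʳ-inject₁ (y Vec.∷ xs) x (Fin.suc i) = lookup-∷ʳ-inject₁ xs x i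

lookup-fromℕ : ∀ {A : Set} {n} (xs : Vec.Vec A (suc n)) → Vec.lookup xs (fromℕ n) ≡ Vec.last xs
lookup-fromℕ (x Vec.∷ Vec.[])     = refl
lookup-fromℕ (x Vec.∷ y Vec.∷ xs) = lookup-fromℕ (y Vec.∷ xs)

lookup-bernoulliVec : ∀ n (i : Fin (suc n)) → Vec.lookup (bernoulliVec n) i ≡ B⁺ (toℕ i)
lookup-bernoulliVec zero    Fin.zero = refl
lookup-bernoulliVec (suc n) i with view i
... | ‵fromℕ = trans (lookup-fromℕ (bernoulliVec (suc n))) (cong B⁺ (sym (toℕ-fromℕ (suc n))))
... | ‵inject₁ j = begin
  Vec.lookup (bernoulliVec n Vec.∷ʳ _) (inject₁ j) ≡⟨ lookup-∷ʳ-inject₁ (bernoulliVec n) _ j ⟩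
  Vec.lookup (bernoulliVec n) j                    ≡⟨ lookup-bernoulliVec n j ⟩
  B⁺ (toℕ j)                                       ≡⟨ cong B⁺ (toℕ-inject₁ j) ⟨
  B⁺ (toℕ (inject₁ j))                             ∎
  where open ≡-Reasoning

B⁺-suc : ∀ n → B⁺ (suc n) ≡
  (ℕ→ℚ (2 + n) ℚ.- (∑[ j < suc n ] ℕ→ℚ ((2 + n) C j) ℚ.* B⁺ j)) ℚ.* (ℤ.+ 1 ℚ./ (2 + n))
B⁺-suc n = trans (last-∷ʳ _ (bernoulliVec n))
  (cong (λ p → (ℕ→ℚ (2 + n) ℚ.- p) ℚ.* (ℤ.+ 1 ℚ./ (2 + n)))
        (foldr-+-tabulate (suc n) _ (λ j → ℕ→ℚ ((2 + n) C j) ℚ.* B⁺ j)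
                          (λ i → cong (ℕ→ℚ ((2 + n) C toℕ i) ℚ.*_) (lookup-bernoulliVec n i))))

B⁺-recurrence : ∀ n → ∑[ j < suc n ] ℕ→ℚ (suc n C j) ℚ.* B⁺ j ≡ ℕ→ℚ (suc n)
B⁺-recurrence zero    = refl
B⁺-recurrence (suc n) = begin
  ∑[ j < 2 + n ] ℕ→ℚ ((2 + n) C j) ℚ.* B⁺ j
    ≡⟨ ∑-init-last (suc n) (λ j → ℕ→ℚ ((2 + n) C j) ℚ.* B⁺ j) ⟩
  p ℚ.+ ℕ→ℚ ((2 + n) C suc n) ℚ.* B⁺ (suc n)
    ≡⟨ cong₂ (λ c b → p ℚ.+ ℕ→ℚ c ℚ.* b) ([1+n]Cn≡1+n (suc n)) (B⁺-suc n) ⟩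
  p ℚ.+ a ℚ.* ((a ℚ.- p) ℚ.* (ℤ.+ 1 ℚ./ (2 + n)))
    ≡⟨ cong (p ℚ.+_) (ℚ*.x∙yz≈y∙xz a (a ℚ.- p) _) ⟩
  p ℚ.+ (a ℚ.- p) ℚ.* (a ℚ.* (ℤ.+ 1 ℚ./ (2 + n)))
    ≡⟨ cong (λ y → p ℚ.+ (a ℚ.- p) ℚ.* y) (ℕ→ℚ-*-inverseʳ (suc n)) ⟩
  p ℚ.+ (a ℚ.- p) ℚ.* 1ℚ
    ≡⟨ cancel p a ⟩
  a ∎
  where
  open ≡-Reasoning
  open +-*-Solver
  p : ℚ
  p = ∑[ j < suc n ] ℕ→ℚ ((2 + n) C j) ℚ.* B⁺ j
  a : ℚ
  a = ℕ→ℚ (2 + n)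
  cancel : ∀ p a → p ℚ.+ (a ℚ.- p) ℚ.* 1ℚ ≡ a
  cancel = solve 2 (λ p a → p :+ (a :- p) :* con 1ℚ := a) refl

B⁺-binomial-sum : ∀ m {N} → m < N → ∑[ j < N ] ℕ→ℚ (m C j) ℚ.* B⁺ j ≡ ℕ→ℚ m ℚ.+ B⁺ m
B⁺-binomial-sum m {N} m<N =
  trans (∑-extend (λ j → ℕ→ℚ (m C j) ℚ.* B⁺ j) m<N vanishing) (exact m)
  where
  vanishing : ∀ {j} → suc m ≤ j → j < N → ℕ→ℚ (m C j) ℚ.* B⁺ j ≡ 0ℚ
  vanishing {j} m<j _ =
    trans (cong (λ c → ℕ→ℚ c ℚ.* B⁺ j) (k>n⇒nCk≡0 m<j)) (ℚₚ.*-zeroˡ (B⁺ j))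
  exact : ∀ m → ∑[ j < suc m ] ℕ→ℚ (m C j) ℚ.* B⁺ j ≡ ℕ→ℚ m ℚ.+ B⁺ m
  exact zero    = refl
  exact (suc n) = begin
    ∑[ j < 2 + n ] ℕ→ℚ (suc n C j) ℚ.* B⁺ j
      ≡⟨ ∑-init-last (suc n) (λ j → ℕ→ℚ (suc n C j) ℚ.* B⁺ j) ⟩
    (∑[ j < suc n ] ℕ→ℚ (suc n C j) ℚ.* B⁺ j) ℚ.+ ℕ→ℚ (suc n C suc n) ℚ.* B⁺ (suc n)
      ≡⟨ cong₂ (λ s c → s ℚ.+ ℕ→ℚ c ℚ.* B⁺ (suc n)) (B⁺-recurrence n) (nCn≡1 (suc n)) ⟩
    ℕ→ℚ (suc n) ℚ.+ 1ℚ ℚ.* B⁺ (suc n)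
      ≡⟨ cong (ℕ→ℚ (suc n) ℚ.+_) (ℚₚ.*-identityˡ _) ⟩
    ℕ→ℚ (suc n) ℚ.+ B⁺ (suc n) ∎
    where open ≡-Reasoning

-- Faulhaber's formula

-- B_m(x + 1) for the Bernoulli polynomial B_m, since B⁺_j = B_j(1).
bernoulliPoly : ℕ → ℕ → ℚ
bernoulliPoly m x = ∑[ j < suc m ] ℕ→ℚ ((m C j) * x ^ (m ∸ j)) ℚ.* B⁺ j

bernoulliPoly-init-last : ∀ m x →
  bernoulliPoly m x ≡ (∑[ j < m ] ℕ→ℚ ((m C j) * x ^ (m ∸ j)) ℚ.* B⁺ j) ℚ.+ B⁺ m
bernoulliPoly-init-last m x = begin
  bernoulliPoly m x
    ≡⟨ ∑-init-last m t ⟩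
  ∑ m t ℚ.+ ℕ→ℚ ((m C m) * x ^ (m ∸ m)) ℚ.* B⁺ m
    ≡⟨ cong₂ (λ c e → ∑ m t ℚ.+ ℕ→ℚ (c * x ^ e) ℚ.* B⁺ m) (nCn≡1 m) (n∸n≡0 m) ⟩
  ∑ m t ℚ.+ 1ℚ ℚ.* B⁺ m
    ≡⟨ cong (∑ m t ℚ.+_) (ℚₚ.*-identityˡ (B⁺ m)) ⟩
  ∑ m t ℚ.+ B⁺ m ∎
  where
  open ≡-Reasoning
  t : ℕ → ℚ
  t j = ℕ→ℚ ((m C j) * x ^ (m ∸ j)) ℚ.* B⁺ j

bernoulliPoly-zero : ∀ m → bernoulliPoly m 0 ≡ B⁺ m
bernoulliPoly-zero m = trans (bernoulliPoly-init-last m 0)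
  (trans (cong (ℚ._+ B⁺ m) (∑-zero m vanishing)) (ℚₚ.+-identityˡ (B⁺ m)))
  where
  0^-positive : ∀ {n} → 0 < n → 0 ^ n ≡ 0
  0^-positive {suc n} _ = refl
  vanishing : ∀ {j} → j < m → ℕ→ℚ ((m C j) * 0 ^ (m ∸ j)) ℚ.* B⁺ j ≡ 0ℚ
  vanishing {j} j<m = trans (cong (λ c → ℕ→ℚ c ℚ.* B⁺ j) term≡0) (ℚₚ.*-zeroˡ (B⁺ j))
    where
    term≡0 : (m C j) * 0 ^ (m ∸ j) ≡ 0
    term≡0 = trans (cong ((m C j) *_) (0^-positive (m<n⇒0<n∸m j<m))) (*-zeroʳ (m C j))

bernoulliPoly-reverse : ∀ m x →
  bernoulliPoly m x ≡ ∑[ i < suc m ] ℕ→ℚ ((m C i) * x ^ i) ℚ.* B⁺ (m ∸ i)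
bernoulliPoly-reverse m x =
  trans (∑-reverse (suc m) (λ j → ℕ→ℚ ((m C j) * x ^ (m ∸ j)) ℚ.* B⁺ j))
  (∑-cong (suc m) (λ {i} i<1+m → cong₂ (λ c e → ℕ→ℚ (c * x ^ e) ℚ.* B⁺ (m ∸ i))
    (sym (nCk≡nC[n∸k] (s≤s⁻¹ i<1+m))) (m∸[m∸n]≡n (s≤s⁻¹ i<1+m))))

private
  expand-term : ∀ m x j → ℕ→ℚ ((m C j) * suc x ^ (m ∸ j)) ℚ.* B⁺ j ≡
    ∑[ i < suc m ] ℕ→ℚ ((m C i) * x ^ i) ℚ.* (ℕ→ℚ ((m ∸ i) C j) ℚ.* B⁺ j)
  expand-term m x j = begin
    ℕ→ℚ ((m C j) * suc x ^ (m ∸ j)) ℚ.* B⁺ j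
      ≡⟨ cong (ℚ._* B⁺ j) (ℕ→ℚ-homo-* (m C j) (suc x ^ (m ∸ j))) ⟩
    ℕ→ℚ (m C j) ℚ.* ℕ→ℚ (suc x ^ (m ∸ j)) ℚ.* B⁺ j
      ≡⟨ cong (λ p → ℕ→ℚ (m C j) ℚ.* p ℚ.* B⁺ j)
              (binomial-expansion x (m ∸ j) (s≤s (m∸n≤m m j))) ⟨
    ℕ→ℚ (m C j) ℚ.* (∑[ i < suc m ] b i) ℚ.* B⁺ j
      ≡⟨ cong (ℚ._* B⁺ j) (*-distribˡ-∑ (suc m) (ℕ→ℚ (m C j)) b) ⟩
    (∑[ i < suc m ] ℕ→ℚ (m C j) ℚ.* b i) ℚ.* B⁺ j
      ≡⟨ *-distribʳ-∑ (suc m) (B⁺ j) (λ i → ℕ→ℚ (m C j) ℚ.* b i) ⟩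
    ∑[ i < suc m ] ℕ→ℚ (m C j) ℚ.* b i ℚ.* B⁺ j
      ≡⟨ ∑-cong (suc m) (λ {i} _ → regroup i) ⟩
    ∑[ i < suc m ] ℕ→ℚ ((m C i) * x ^ i) ℚ.* (ℕ→ℚ ((m ∸ i) C j) ℚ.* B⁺ j) ∎
    where
    open ≡-Reasoning
    b : ℕ → ℚ
    b i = ℕ→ℚ (((m ∸ j) C i) * x ^ i)
    choose-swap : ∀ i → (m C j) * (((m ∸ j) C i) * x ^ i) ≡ (m C i) * x ^ i * ((m ∸ i) C j)
    choose-swap i = begin
      (m C j) * (((m ∸ j) C i) * x ^ i)  ≡⟨ *-assoc (m C j) _ _ ⟨
      (m C j) * ((m ∸ j) C i) * x ^ i    ≡⟨ cong (_* x ^ i) (nCj*[n∸j]Ci≡nCi*[n∸i]Cj m i j) ⟩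
      (m C i) * ((m ∸ i) C j) * x ^ i    ≡⟨ ℕ*.xy∙z≈xz∙y (m C i) _ _ ⟩
      (m C i) * x ^ i * ((m ∸ i) C j)    ∎
    regroup : ∀ i → ℕ→ℚ (m C j) ℚ.* b i ℚ.* B⁺ j ≡
                    ℕ→ℚ ((m C i) * x ^ i) ℚ.* (ℕ→ℚ ((m ∸ i) C j) ℚ.* B⁺ j)
    regroup i = begin
      ℕ→ℚ (m C j) ℚ.* b i ℚ.* B⁺ j
        ≡⟨ cong (ℚ._* B⁺ j) (ℕ→ℚ-homo-* (m C j) (((m ∸ j) C i) * x ^ i)) ⟨
      ℕ→ℚ ((m C j) * (((m ∸ j) C i) * x ^ i)) ℚ.* B⁺ j
        ≡⟨ cong (λ c → ℕ→ℚ c ℚ.* B⁺ j) (choose-swap i) ⟩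
      ℕ→ℚ ((m C i) * x ^ i * ((m ∸ i) C j)) ℚ.* B⁺ j
        ≡⟨ cong (ℚ._* B⁺ j) (ℕ→ℚ-homo-* ((m C i) * x ^ i) ((m ∸ i) C j)) ⟩
      ℕ→ℚ ((m C i) * x ^ i) ℚ.* ℕ→ℚ ((m ∸ i) C j) ℚ.* B⁺ j
        ≡⟨ ℚₚ.*-assoc (ℕ→ℚ ((m C i) * x ^ i)) (ℕ→ℚ ((m ∸ i) C j)) (B⁺ j) ⟩
      ℕ→ℚ ((m C i) * x ^ i) ℚ.* (ℕ→ℚ ((m ∸ i) C j) ℚ.* B⁺ j) ∎

  binomial-expansion-absorbed : ∀ m x →
    ∑[ i < suc m ] ℕ→ℚ ((m C i) * x ^ i) ℚ.* ℕ→ℚ (m ∸ i) ≡ ℕ→ℚ (m * suc x ^ (m ∸ 1))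
  binomial-expansion-absorbed m x = begin
    ∑[ i < suc m ] ℕ→ℚ ((m C i) * x ^ i) ℚ.* ℕ→ℚ (m ∸ i)
      ≡⟨ ∑-cong (suc m) (λ {i} _ → absorb i) ⟩
    ∑[ i < suc m ] ℕ→ℚ m ℚ.* ℕ→ℚ (((m ∸ 1) C i) * x ^ i)
      ≡⟨ *-distribˡ-∑ (suc m) (ℕ→ℚ m) (λ i → ℕ→ℚ (((m ∸ 1) C i) * x ^ i)) ⟨
    ℕ→ℚ m ℚ.* (∑[ i < suc m ] ℕ→ℚ (((m ∸ 1) C i) * x ^ i))
      ≡⟨ cong (ℕ→ℚ m ℚ.*_) (binomial-expansion x (m ∸ 1) (s≤s (m∸n≤m m 1))) ⟩
    ℕ→ℚ m ℚ.* ℕ→ℚ (suc x ^ (m ∸ 1))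
      ≡⟨ ℕ→ℚ-homo-* m (suc x ^ (m ∸ 1)) ⟨
    ℕ→ℚ (m * suc x ^ (m ∸ 1)) ∎
    where
    open ≡-Reasoning
    absorb : ∀ i → ℕ→ℚ ((m C i) * x ^ i) ℚ.* ℕ→ℚ (m ∸ i) ≡
                   ℕ→ℚ m ℚ.* ℕ→ℚ (((m ∸ 1) C i) * x ^ i)
    absorb i = begin
      ℕ→ℚ ((m C i) * x ^ i) ℚ.* ℕ→ℚ (m ∸ i)  ≡⟨ ℕ→ℚ-homo-* ((m C i) * x ^ i) (m ∸ i) ⟨
      ℕ→ℚ ((m C i) * x ^ i * (m ∸ i))        ≡⟨ cong ℕ→ℚ (ℕ*.xy∙z≈xz∙y (m C i) (x ^ i) (m ∸ i)) ⟩
      ℕ→ℚ ((m C i) * (m ∸ i) * x ^ i)        ≡⟨ cong (λ c → ℕ→ℚ (c * x ^ i)) (nCk*[n∸k]≡n*[n∸1]Ck m i) ⟩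
      ℕ→ℚ (m * ((m ∸ 1) C i) * x ^ i)        ≡⟨ cong ℕ→ℚ (*-assoc m ((m ∸ 1) C i) (x ^ i)) ⟩
      ℕ→ℚ (m * (((m ∸ 1) C i) * x ^ i))      ≡⟨ ℕ→ℚ-homo-* m (((m ∸ 1) C i) * x ^ i) ⟩
      ℕ→ℚ m ℚ.* ℕ→ℚ (((m ∸ 1) C i) * x ^ i)  ∎

bernoulliPoly-suc : ∀ m x →
  bernoulliPoly m (suc x) ≡ bernoulliPoly m x ℚ.+ ℕ→ℚ (m * suc x ^ (m ∸ 1))
bernoulliPoly-suc m x = begin
  bernoulliPoly m (suc x)
    ≡⟨ ∑-cong (suc m) (λ {j} _ → expand-term m x j) ⟩
  ∑[ j < suc m ] ∑[ i < suc m ] a i ℚ.* (c i j ℚ.* B⁺ j)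
    ≡⟨ ∑-comm (suc m) (suc m) (λ j i → a i ℚ.* (c i j ℚ.* B⁺ j)) ⟩
  ∑[ i < suc m ] ∑[ j < suc m ] a i ℚ.* (c i j ℚ.* B⁺ j)
    ≡⟨ ∑-cong (suc m) (λ {i} _ → *-distribˡ-∑ (suc m) (a i) (λ j → c i j ℚ.* B⁺ j)) ⟨
  ∑[ i < suc m ] a i ℚ.* (∑[ j < suc m ] c i j ℚ.* B⁺ j)
    ≡⟨ ∑-cong (suc m) (λ {i} _ → cong (a i ℚ.*_) (B⁺-binomial-sum (m ∸ i) (s≤s (m∸n≤m m i)))) ⟩
  ∑[ i < suc m ] a i ℚ.* (ℕ→ℚ (m ∸ i) ℚ.+ B⁺ (m ∸ i))
    ≡⟨ ∑-cong (suc m) (λ {i} _ → ℚₚ.*-distribˡ-+ (a i) (ℕ→ℚ (m ∸ i)) (B⁺ (m ∸ i))) ⟩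
  ∑[ i < suc m ] (a i ℚ.* ℕ→ℚ (m ∸ i) ℚ.+ a i ℚ.* B⁺ (m ∸ i))
    ≡⟨ ∑-distrib-+ (suc m) (λ i → a i ℚ.* ℕ→ℚ (m ∸ i)) (λ i → a i ℚ.* B⁺ (m ∸ i)) ⟩
  (∑[ i < suc m ] a i ℚ.* ℕ→ℚ (m ∸ i)) ℚ.+ (∑[ i < suc m ] a i ℚ.* B⁺ (m ∸ i))
    ≡⟨ cong₂ ℚ._+_ (binomial-expansion-absorbed m x) (sym (bernoulliPoly-reverse m x)) ⟩
  ℕ→ℚ (m * suc x ^ (m ∸ 1)) ℚ.+ bernoulliPoly m x
    ≡⟨ ℚₚ.+-comm (ℕ→ℚ (m * suc x ^ (m ∸ 1))) (bernoulliPoly m x) ⟩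
  bernoulliPoly m x ℚ.+ ℕ→ℚ (m * suc x ^ (m ∸ 1)) ∎
  where
  open ≡-Reasoning
  a : ℕ → ℚ
  a i = ℕ→ℚ ((m C i) * x ^ i)
  c : ℕ → ℕ → ℚ
  c i j = ℕ→ℚ ((m ∸ i) C j)

bernoulliPoly-powerSum : ∀ k x → bernoulliPoly (suc k) x ≡ ℕ→ℚ (suc k * S k x) ℚ.+ B⁺ (suc k)
bernoulliPoly-powerSum k zero = begin
  bernoulliPoly (suc k) 0            ≡⟨ bernoulliPoly-zero (suc k) ⟩
  B⁺ (suc k)                         ≡⟨ ℚₚ.+-identityˡ (B⁺ (suc k)) ⟨
  0ℚ ℚ.+ B⁺ (suc k)                  ≡⟨ cong (λ n → ℕ→ℚ n ℚ.+ B⁺ (suc k)) (*-zeroʳ (suc k)) ⟨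
  ℕ→ℚ (suc k * 0) ℚ.+ B⁺ (suc k)     ∎
  where open ≡-Reasoning
bernoulliPoly-powerSum k (suc x) = begin
  bernoulliPoly (suc k) (suc x)
    ≡⟨ bernoulliPoly-suc (suc k) x ⟩
  bernoulliPoly (suc k) x ℚ.+ ℕ→ℚ (suc k * suc x ^ k)
    ≡⟨ cong (ℚ._+ ℕ→ℚ (suc k * suc x ^ k)) (bernoulliPoly-powerSum k x) ⟩
  ℕ→ℚ (suc k * S k x) ℚ.+ B⁺ (suc k) ℚ.+ ℕ→ℚ (suc k * suc x ^ k)
    ≡⟨ ℚ+.xy∙z≈xz∙y (ℕ→ℚ (suc k * S k x)) (B⁺ (suc k)) (ℕ→ℚ (suc k * suc x ^ k)) ⟩
  ℕ→ℚ (suc k * S k x) ℚ.+ ℕ→ℚ (suc k * suc x ^ k) ℚ.+ B⁺ (suc k)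
    ≡⟨ cong (ℚ._+ B⁺ (suc k)) (ℕ→ℚ-homo-+ (suc k * S k x) (suc k * suc x ^ k)) ⟨
  ℕ→ℚ (suc k * S k x + suc k * suc x ^ k) ℚ.+ B⁺ (suc k)
    ≡⟨ cong (λ n → ℕ→ℚ n ℚ.+ B⁺ (suc k)) (*-distribˡ-+ (suc k) (S k x) (suc x ^ k)) ⟨
  ℕ→ℚ (suc k * S k (suc x)) ℚ.+ B⁺ (suc k) ∎
  where open ≡-Reasoning

faulhaber : ∀ k x → bernoulliSum k x ≡ ℕ→ℚ (suc k * S k x)
faulhaber k x = ℚ+-group.∙-cancelʳ (B⁺ (suc k)) (bernoulliSum k x) (ℕ→ℚ (suc k * S k x)) (begin
  bernoulliSum k x ℚ.+ B⁺ (suc k)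
    ≡⟨ cong (ℚ._+ B⁺ (suc k)) (sumℚ-map-applyUpTo (suc k) t (λ j → j)) ⟩
  ∑ (suc k) t ℚ.+ B⁺ (suc k)
    ≡⟨ bernoulliPoly-init-last (suc k) x ⟨
  bernoulliPoly (suc k) x
    ≡⟨ bernoulliPoly-powerSum k x ⟩
  ℕ→ℚ (suc k * S k x) ℚ.+ B⁺ (suc k) ∎)
  where
  open ≡-Reasoning
  t : ℕ → ℚ
  t j = ℕ→ℚ ((suc k C j) * x ^ (suc k ∸ j)) ℚ.* B⁺ j

-- Bounds on power sums

bernoulli-inequality : ∀ k a → a ^ suc k + suc k * a ^ k ≤ suc a ^ suc k
bernoulli-inequality zero    a = ≤-reflexive (identity a)
  where
  identity : ∀ a → a * 1 + 1 * 1 ≡ (1 + a) * 1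
  identity = solve-∀
bernoulli-inequality (suc k) a = begin
  a ^ (2 + k) + (2 + k) * a ^ suc k                      ≤⟨ m≤m+n _ (suc k * a ^ k) ⟩
  a ^ (2 + k) + (2 + k) * a ^ suc k + suc k * a ^ k      ≡⟨ factor a k (a ^ k) ⟩
  suc a * (a ^ suc k + suc k * a ^ k)                    ≤⟨ *-monoʳ-≤ (suc a) (bernoulli-inequality k a) ⟩
  suc a * suc a ^ suc k                                  ∎
  where
  open ≤-Reasoning
  factor : ∀ a k p → a * (a * p) + (2 + k) * (a * p) + (1 + k) * p ≡ (1 + a) * (a * p + (1 + k) * p)
  factor = solve-∀

powerSum-upperBound : ∀ k m → suc k * S k m < suc m ^ suc k
powerSum-upperBound k zero = subst₂ _<_ (sym (*-zeroʳ (suc k))) (sym (^-zeroˡ (suc k))) z<s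
powerSum-upperBound k (suc m) = begin-strict
  suc k * (S k m + suc m ^ k)            ≡⟨ *-distribˡ-+ (suc k) (S k m) (suc m ^ k) ⟩
  suc k * S k m + suc k * suc m ^ k      <⟨ +-monoˡ-< (suc k * suc m ^ k) (powerSum-upperBound k m) ⟩
  suc m ^ suc k + suc k * suc m ^ k      ≤⟨ bernoulli-inequality k (suc m) ⟩
  suc (suc m) ^ suc k                    ∎
  where open ≤-Reasoning

powerSum-lowerBound-step : ∀ k b → 2 ≤ k → 1 ≤ b →
                           suc b ^ suc k + suc k ≤ suc k * suc b ^ k + b ^ suc k
powerSum-lowerBound-step 1 _ (s≤s ()) _
powerSum-lowerBound-step 2 (suc c) _ _ = ≤-trans (m≤m+n _ (3 * c + 2)) (≤-reflexive (identity c))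
  where
  identity : ∀ c → (2 + c) * ((2 + c) * ((2 + c) * 1)) + 3 + (3 * c + 2) ≡
                   3 * ((2 + c) * ((2 + c) * 1)) + (1 + c) * ((1 + c) * ((1 + c) * 1))
  identity = solve-∀
powerSum-lowerBound-step (suc k@(suc (suc _))) b _ 1≤b = begin
  a * A + suc K                     ≤⟨ +-monoʳ-≤ (a * A) 1+K≤a*K ⟩
  a * A + a * K                     ≡⟨ *-distribˡ-+ a A K ⟨
  a * (A + K)                       ≤⟨ *-monoʳ-≤ a (powerSum-lowerBound-step k b (s≤s (s≤s z≤n)) 1≤b) ⟩
  a * (K * a ^ k + b ^ K)           ≡⟨ expand b K (a ^ k) (b ^ K) ⟩
  K * A + b * b ^ K + b ^ K         ≤⟨ +-monoʳ-≤ (K * A + b * b ^ K) (^-monoˡ-≤ K (n≤1+n b)) ⟩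
  K * A + b * b ^ K + A             ≡⟨ collect K A (b * b ^ K) ⟩
  suc K * A + b * b ^ K             ∎
  where
  open ≤-Reasoning
  a K A : ℕ
  a = suc b
  K = suc k
  A = a ^ K
  1+K≤a*K : suc K ≤ a * K
  1+K≤a*K = ≤-trans (≤-reflexive (+-comm 1 K)) (+-monoʳ-≤ K (≤-trans 1≤b (m≤m*n b K)))
  expand : ∀ b n p q → (1 + b) * (n * p + q) ≡ n * ((1 + b) * p) + b * q + q
  expand = solve-∀
  collect : ∀ n A q → n * A + q + A ≡ (1 + n) * A + q
  collect = solve-∀

powerSum-lowerBound : ∀ k m → 2 ≤ k → suc m ^ suc k + suc k * m ≤ suc k * S k (suc m)
powerSum-lowerBound k zero _
  rewrite ^-zeroˡ (suc k) | ^-zeroˡ k | *-zeroʳ (suc k) | *-identityʳ (suc k) = s≤s z≤n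
powerSum-lowerBound k (suc m) 2≤k = begin
  a ^ K + K * suc m                   ≡⟨ cong ((a ^ K) +_) (*-suc K m) ⟩
  a ^ K + (K + K * m)                 ≡⟨ +-assoc (a ^ K) K (K * m) ⟨
  a ^ K + K + K * m                   ≤⟨ +-monoˡ-≤ (K * m) (powerSum-lowerBound-step k (suc m) 2≤k (s≤s z≤n)) ⟩
  K * a ^ k + suc m ^ K + K * m       ≡⟨ +-assoc (K * a ^ k) _ _ ⟩
  K * a ^ k + (suc m ^ K + K * m)     ≤⟨ +-monoʳ-≤ (K * a ^ k) (powerSum-lowerBound k m 2≤k) ⟩
  K * a ^ k + K * S k (suc m)         ≡⟨ +-comm (K * a ^ k) _ ⟩
  K * S k (suc m) + K * a ^ k         ≡⟨ *-distribˡ-+ K (S k (suc m)) (a ^ k) ⟨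
  K * S k (suc (suc m))               ∎
  where
  open ≤-Reasoning
  K a : ℕ
  K = suc k
  a = suc (suc m)

AllPairs-lookup : ∀ {A : Set} {R : A → A → Set} {xs} → AllPairs R xs →
                  ∀ {i j} → i Fin.< j → R (List.lookup xs i) (List.lookup xs j)
AllPairs-lookup (Rx ∷ _)  {Fin.zero}  {Fin.suc j} _         = All.lookup Rx (∈-lookup j)
AllPairs-lookup (_ ∷ Rxs) {Fin.suc i} {Fin.suc j} (s≤s i<j) = AllPairs-lookup Rxs i<j

record Enumerates (P : ℕ → Set) (b : ℕ) (xs : List ℕ) : Set where
  field
    increasing : AllPairs _<_ xs
    sound      : All (λ x → P x × x < b) xs
    complete   : ∀ {x} → P x → x < b → x ∈ xs

module _ {P : ℕ → Set} where

  enumerates-[] : Enumerates P 0 []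
  enumerates-[] = record { increasing = [] ; sound = [] ; complete = λ _ () }

  enumerates-skip : ∀ {b xs} → ¬ P b → Enumerates P b xs → Enumerates P (suc b) xs
  enumerates-skip {b} {xs} ¬Pb e = record
    { increasing = increasing
    ; sound      = All.map (Product.map₂ m<n⇒m<1+n) sound
    ; complete   = complete′
    }
    where
    open Enumerates e
    complete′ : ∀ {x} → P x → x < suc b → x ∈ xs
    complete′ Px x<1+b with m<1+n⇒m<n∨m≡n x<1+b
    ... | inj₁ x<b  = complete Px x<b
    ... | inj₂ refl = contradiction Px ¬Pb

  enumerates-∷ʳ : ∀ {b xs} → P b → Enumerates P b xs → Enumerates P (suc b) (xs ∷ʳ b)
  enumerates-∷ʳ {b} {xs} Pb e = record
    { increasing = AllPairsₚ.++⁺ increasing ([] ∷ []) (All.map (λ (_ , x<b) → x<b ∷ []) sound)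
    ; sound      = Allₚ.++⁺ (All.map (Product.map₂ m<n⇒m<1+n) sound) ((Pb , n<1+n b) ∷ [])
    ; complete   = complete′
    }
    where
    open Enumerates e
    complete′ : ∀ {x} → P x → x < suc b → x ∈ xs ∷ʳ b
    complete′ Px x<1+b with m<1+n⇒m<n∨m≡n x<1+b
    ... | inj₁ x<b  = ∈-++⁺ˡ (complete Px x<b)
    ... | inj₂ refl = ∈-++⁺ʳ xs (here refl)

  enumerates⇒nthSmallest : ∀ {a xs} → Enumerates P (suc a) xs → P a → NthSmallest P (length xs) a
  enumerates⇒nthSmallest {a} {xs} e Pa =
    List.lookup xs ,
    (λ _ _ → AllPairs-lookup increasing) ,
    (λ i → proj₁ (element i)) ,
    (λ i → s≤s⁻¹ (proj₂ (element i))) ,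
    (λ x Px x≤a → let x∈xs = complete Px (s≤s x≤a) in Any.index x∈xs , sym (lookup-index x∈xs)) ,
    Pa
    where
    open Enumerates e
    element : ∀ i → P (List.lookup xs i) × List.lookup xs i < suc a
    element i = All.lookup sound (∈-lookup i)

-- Numbers that are not power sums

S-<-suc : ∀ k m → S k m < S k (suc m)
S-<-suc k m = m<m+n (S k m) (m^n>0 (suc m) k)

S-mono-≤ : ∀ k {m n} → m ≤ n → S k m ≤ S k n
S-mono-≤ k m≤n = go (≤⇒≤′ m≤n)
  where
  go : ∀ {m n} → m ≤′ n → S k m ≤ S k n
  go ≤′-refl         = ≤-refl
  go (≤′-step m≤′n) = ≤-trans (go m≤′n) (<⇒≤ (S-<-suc k _))

S-mono-< : ∀ k {m n} → m < n → S k m < S k n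
S-mono-< k {m} m<n = <-≤-trans (S-<-suc k m) (S-mono-≤ k m<n)

notPowerSum-between : ∀ k {t x} → S k t < x → x < S k (suc t) → NotPowerSum k x
notPowerSum-between k {t} {x} St<x x<S[1+t] = ≤-trans (s≤s z≤n) St<x , λ m _ → S≢x m
  where
  S≢x : ∀ m → S k m ≢ x
  S≢x m Sm≡x with m ≤? t
  ... | yes m≤t = <⇒≱ St<x (≤-trans (≤-reflexive (sym Sm≡x)) (S-mono-≤ k m≤t))
  ... | no  m≰t = <⇒≱ x<S[1+t] (≤-trans (S-mono-≤ k (≰⇒> m≰t)) (≤-reflexive Sm≡x))

enumerate-nonPowerSums : ∀ k t y → S k t ≤ y → y < S k (suc t) →
  ∃ λ xs → Enumerates (NotPowerSum k) (suc y) xs × length xs + t ≡ y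
enumerate-nonPowerSums k zero    zero _ _ =
  [] , enumerates-skip (λ { (() , _) }) enumerates-[] , refl
enumerate-nonPowerSums k (suc t) zero S[1+t]≤0 _ =
  contradiction S[1+t]≤0 (<⇒≱ (S-mono-< k z<s))
enumerate-nonPowerSums k t (suc y) St≤1+y 1+y<S[1+t] with m≤n⇒m<n∨m≡n St≤1+y
... | inj₁ St<1+y =
  let xs , e , len = enumerate-nonPowerSums k t y (s≤s⁻¹ St<1+y) (<-trans (n<1+n y) 1+y<S[1+t])
  in  xs ∷ʳ suc y
    , enumerates-∷ʳ (notPowerSum-between k St<1+y 1+y<S[1+t]) e
    , trans (cong (_+ t) (trans (length-++ xs) (+-comm (length xs) 1))) (cong suc len)
enumerate-nonPowerSums k zero    (suc y) _ _ | inj₂ ()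
enumerate-nonPowerSums k (suc t) (suc y) _ _ | inj₂ S[1+t]≡1+y =
  let xs , e , len = enumerate-nonPowerSums k t y
                       (s≤s⁻¹ (subst (S k t <_) S[1+t]≡1+y (S-<-suc k t))) (≤-reflexive (sym S[1+t]≡1+y))
  in  xs
    , enumerates-skip (λ (_ , S≢) → S≢ (suc t) (s≤s z≤n) S[1+t]≡1+y) e
    , trans (+-suc (length xs) t) (cong suc len)

nonPowerSum-nth : ∀ k {n t} → S k t < n + t → n + t < S k (suc t) →
                  NthSmallest (NotPowerSum k) n (n + t)
nonPowerSum-nth k {n} {t} lo hi =
  let xs , e , len = enumerate-nonPowerSums k t (n + t) (<⇒≤ lo) hi
  in  subst (λ c → NthSmallest (NotPowerSum k) c (n + t)) (+-cancelʳ-≡ t (length xs) n len)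
            (enumerates⇒nthSmallest e (notPowerSum-between k lo hi))

bernoulliSum<⇔powerSum< : ∀ k s x → bernoulliSum k s ℚ.< ℕ→ℚ (suc k * x) ⇔ S k s < x
bernoulliSum<⇔powerSum< k s x = mk⇔
  (λ lt → *-cancelˡ-< (suc k) (S k s) x (ℕ→ℚ-cancel-< (subst (ℚ._< _) (faulhaber k s) lt)))
  (λ lt → subst (ℚ._< _) (sym (faulhaber k s)) (ℕ→ℚ-mono-< (*-monoʳ-< (suc k) lt)))

nonPowerSum-nth-above : ∀ k {n s} → 2 ≤ k → suc k * n < suc s ^ suc k → S k s < n + s →
                        NthSmallest (NotPowerSum k) n (n + s)
nonPowerSum-nth-above k {n} {s} 2≤k Kn<[1+s]ᴷ Ss<n+s =
  nonPowerSum-nth k Ss<n+s (*-cancelˡ-< (suc k) (n + s) (S k (suc s)) (begin-strict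
    suc k * (n + s)             ≡⟨ *-distribˡ-+ (suc k) n s ⟩
    suc k * n + suc k * s       <⟨ +-monoˡ-< (suc k * s) Kn<[1+s]ᴷ ⟩
    suc s ^ suc k + suc k * s   ≤⟨ powerSum-lowerBound k s 2≤k ⟩
    suc k * S k (suc s)         ∎))
  where open ≤-Reasoning

nonPowerSum-nth-below : ∀ k {n s} → 1 ≤ n → s ^ suc k ≤ suc k * n → n + s ≤ S k s →
                        NthSmallest (NotPowerSum k) n (n + s ∸ 1)
nonPowerSum-nth-below k {n} {zero}  1≤n _ n+0≤0 =
  contradiction (≤-trans 1≤n (≤-trans (m≤m+n n 0) n+0≤0)) λ ()
nonPowerSum-nth-below k {n} {suc t} _ [1+t]ᴷ≤Kn n+[1+t]≤S[1+t] =
  subst (NthSmallest (NotPowerSum k) n) (cong (_∸ 1) (sym (+-suc n t)))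
    (nonPowerSum-nth k (<-≤-trans St<n (m≤m+n n t))
                       (≤-trans (≤-reflexive (sym (+-suc n t))) n+[1+t]≤S[1+t]))
  where
  St<n : S k t < n
  St<n = *-cancelˡ-< (suc k) (S k t) n (<-≤-trans (powerSum-upperBound k t) [1+t]ᴷ≤Kn)

theorem7 : (k n s : ℕ) → 1 < k → 1 ≤ n →
    s ^ suc k ≤ suc k * n → suc k * n < suc s ^ suc k →
    (ℕ→ℚ (suc k * (n + s)) > bernoulliSum k s → NthSmallest (NotPowerSum k) n (n + s)) ×
    (¬ (ℕ→ℚ (suc k * (n + s)) > bernoulliSum k s) → NthSmallest (NotPowerSum k) n (n + s ∸ 1))
theorem7 k n s 1<k 1≤n sᴷ≤Kn Kn<[1+s]ᴷ =
    (λ above → nonPowerSum-nth-above k 1<k Kn<[1+s]ᴷ (Equivalence.to faulhaber-< above))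
  , (λ ¬above → nonPowerSum-nth-below k 1≤n sᴷ≤Kn (≮⇒≥ (¬above ∘ Equivalence.from faulhaber-<)))
  where
  faulhaber-< : bernoulliSum k s ℚ.< ℕ→ℚ (suc k * (n + s)) ⇔ S k s < n + s
  faulhaber-< = bernoulliSum<⇔powerSum< k s (n + s)
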